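{- Let $q\ge2$ and $n\ge1$ be integers with $q\le n$. Then under each of the scenarios $(*\circ)$, $(\circ *)$, $(**)$, $(\bullet *)$, $(*\bullet)$, and $(\bullet\bullet)$, every subset $\Phi\subseteq\mathcal{F}_q$ is $n$-cell implementable.
   Context: $[b\rangle=\{0,1,\ldots,b-1\}$. Let $\mathbb{B}=\{0,1\}$, $\mathbb{B}_\circ=\mathbb{B}$, $\mathbb{B}_*=\mathbb{B}\cup\{*\}$, $\mathbb{B}_\bullet=\mathbb{B}\cup\{*,\bullet\}$. Define $\mathrm{T}:\mathbb{B}_\bullet^2\to\mathbb{B}$ by $\mathrm{T}(u,\vartheta)=1$ if and only if $u=*$, or $\vartheta=*$, or $u=\vartheta\in\mathbb{B}$. $\mathcal{F}_q$ is the set of all functions $[q\rangle\to\mathbb{B}$. For $\alpha,\beta\in\{\circ,*,\bullet\}$, a subset $\Phi\subseteq\mathcal{F}_q$ is $n$-cell implementable under scenario $(\alpha\beta)$ if there exist mappings $\mathbf{u}=(u_j)_{j\in[n\rangle}:[q\rangle\to\mathbb{B}_\alpha^n$ and $\boldsymbol{\vartheta}=(\vartheta_j)_{j\in[n\rangle}:\Phi\to\mathbb{B}_\beta^n$ such that $f(x)=\bigwedge_{j\in[n\rangle}\mathrm{T}(u_j(x),\vartheta_j(f))$ for all $f\in\Phi$ and $x\in[q\rangle$. -}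

module Defs where

open import Data.Bool using (Bool; true; false; _∧_)
open import Data.Nat using (ℕ)
open import Data.Fin using (Fin)
open import Data.Product using (Σ; ∃; _×_)
open import Data.Vec.Functional using (Vector; foldr)
open import Relation.Binary.PropositionalEquality using (_≡_)

data Sym : Set where
  b0 b1 star bullet : Sym

-- Scenario markers: ∘ (𝔹), * (𝔹 ∪ {*}), • (𝔹 ∪ {*, •})
data Scen : Set where
  circ ast bul : Scen

data InAlph : Scen → Sym → Set where
  c0 : InAlph circ b0
  c1 : InAlph circ b1
  a0 : InAlph ast b0
  a1 : InAlph ast b1
  a* : InAlph ast star
  u0 : InAlph bul b0
  u1 : InAlph bul b1
  u* : InAlph bul star
  u• : InAlph bul bullet

T : Sym → Sym → Bool
T star _ = true
T _ star = true
T b0 b0 = true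
T b1 b1 = true
T _ _ = false

F : ℕ → Set
F q = Fin q → Bool

⋀ : ∀ {n} → Vector Bool n → Bool
⋀ = foldr _∧_ true

Implementable : (α β : Scen) (q n : ℕ) (Φ : F q → Set) → Set
Implementable α β q n Φ =
  Σ (Fin q → Vector Sym n) λ u →
  Σ (F q → Vector Sym n) λ ϑ →
    ((x : Fin q) (j : Fin n) → InAlph α (u x j)) ×
    ((f : F q) → Φ f → (j : Fin n) → InAlph β (ϑ f j)) ×
    ((f : F q) → Φ f → (x : Fin q) →
       f x ≡ ⋀ (λ j → T (u x j) (ϑ f j)))

{-# OPTIONS --safe #-}
-- A one-hot code: cell j of the n cells is read by input x exactly when j = x.  The key u(x)
-- carries a "reading" symbol at cell x and a neutral symbol everywhere else, while the lock
-- ϑ(f) stores f(j) in cell j; cells j ≥ q store a dummy value that every key accepts.  Then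
-- all cells but the x-th evaluate to 1 and the x-th evaluates to f(x).  Suitable symbols exist
-- in every listed scenario: either u reads with 1 and is neutral with *, and ϑ ∈ {0, 1}; or
-- u ∈ {0, 1} and ϑ ∈ {0, *}, where T(0, ·) is always 1 and T(1, ·) separates * from 0.
module Submission where

open import Defs
open import Data.Nat using (ℕ; _≤_; _<_; _<?_)
open import Data.Bool using (Bool; true; false; _∧_; if_then_else_)
open import Data.Bool.Properties using (∧-identityʳ)
open import Data.Fin using (Fin; zero; suc; toℕ; fromℕ<; inject≤; _≟_)
open import Data.Fin.Properties using (toℕ-fromℕ<; toℕ-inject≤; toℕ-injective; toℕ<n; suc-injective)
open import Function using (_∘_)
open import Data.Product using (_×_; _,_)
open import Data.Sum using (_⊎_; inj₁; inj₂)
open import Relation.Nullary using (¬_; yes; no; does; contradiction)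
open import Relation.Nullary.Decidable using (dec-true; dec-false)
open import Relation.Binary.PropositionalEquality
  using (_≡_; refl; sym; trans; cong; cong₂; subst; module ≡-Reasoning)

⋀-true : ∀ {n} (v : Fin n → Bool) → (∀ j → v j ≡ true) → ⋀ v ≡ true
⋀-true {ℕ.zero}  v all-true = refl
⋀-true {ℕ.suc n} v all-true rewrite all-true zero = ⋀-true (v ∘ suc) (all-true ∘ suc)

⋀-single : ∀ {n} (v : Fin n → Bool) (k : Fin n) → (∀ j → ¬ j ≡ k → v j ≡ true) → ⋀ v ≡ v k
⋀-single v zero others =
  trans (cong (v zero ∧_) (⋀-true _ (λ j → others (suc j) λ ()))) (∧-identityʳ (v zero))
⋀-single v (suc k) others rewrite others zero (λ ()) =
  ⋀-single _ k (λ j j≢k → others (suc j) (j≢k ∘ suc-injective))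

oneHot : ∀ {n} {A : Set} → Fin n → A → A → Fin n → A
oneHot k a b j = if does (j ≟ k) then a else b

oneHot-≡ : ∀ {n} {A : Set} (k : Fin n) {a b : A} → oneHot k a b k ≡ a
oneHot-≡ k rewrite dec-true (k ≟ k) refl = refl

oneHot-≢ : ∀ {n} {A : Set} {k j : Fin n} {a b : A} → ¬ j ≡ k → oneHot k a b j ≡ b
oneHot-≢ {k = k} {j} j≢k rewrite dec-false (j ≟ k) j≢k = refl

oneHot-preserves : ∀ {n} {A : Set} (P : A → Set) (k : Fin n) {a b : A} →
  P a → P b → ∀ j → P (oneHot k a b j)
oneHot-preserves P k pa pb j with does (j ≟ k)
... | true  = pa
... | false = pb

extend : ∀ {q n} {A : Set} → (Fin q → A) → A → Fin n → A
extend {q} f a j with toℕ j <? q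
... | yes j<q = f (fromℕ< j<q)
... | no  _   = a

extend-inject≤ : ∀ {q n} {A : Set} (q≤n : q ≤ n) (f : Fin q → A) (a : A) (x : Fin q) →
  extend f a (inject≤ x q≤n) ≡ f x
extend-inject≤ {q} q≤n f a x with toℕ (inject≤ x q≤n) <? q
... | yes j<q = cong f (toℕ-injective (trans (toℕ-fromℕ< j<q) (toℕ-inject≤ x q≤n)))
... | no  j≮q = contradiction (subst (_< q) (sym (toℕ-inject≤ x q≤n)) (toℕ<n x)) j≮q

record OneHotCode (α β : Scen) : Set where
  field
    reading neutral : Sym
    encode          : Bool → Sym
    reading∈α       : InAlph α reading
    neutral∈α       : InAlph α neutral
    encode∈β        : ∀ b → InAlph β (encode b)
    T-reading       : ∀ b → T reading (encode b) ≡ b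
    T-neutral       : ∀ b → T neutral (encode b) ≡ true

oneHot-implementable : ∀ {α β q n} → OneHotCode α β → q ≤ n →
  (Φ : F q → Set) → Implementable α β q n Φ
oneHot-implementable {α} {β} {q} {n} code q≤n Φ =
  u , ϑ , (λ x → oneHot-preserves (InAlph α) (cell x) reading∈α neutral∈α) ,
  (λ f _ j → encode∈β (extend f true j)) , (λ f _ x → sym (conjunction f x))
  where
  open OneHotCode code
  cell : Fin q → Fin n
  cell x = inject≤ x q≤n
  u : Fin q → Fin n → Sym
  u x = oneHot (cell x) reading neutral
  ϑ : F q → Fin n → Sym
  ϑ f j = encode (extend f true j)
  conjunction : (f : F q) (x : Fin q) → ⋀ (λ j → T (u x j) (ϑ f j)) ≡ f x
  conjunction f x = begin
    ⋀ (λ j → T (u x j) (ϑ f j))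
      ≡⟨ ⋀-single _ (cell x) (λ j j≢x → trans (cong (λ s → T s (ϑ f j)) (oneHot-≢ j≢x)) (T-neutral _)) ⟩
    T (u x (cell x)) (ϑ f (cell x))
      ≡⟨ cong₂ T (oneHot-≡ (cell x)) (cong encode (extend-inject≤ q≤n f true x)) ⟩
    T reading (encode (f x))
      ≡⟨ T-reading (f x) ⟩
    f x ∎
    where open ≡-Reasoning

wildcardKeyCode : ∀ {α β} → InAlph α b1 → InAlph α star → InAlph β b0 → InAlph β b1 →
  OneHotCode α β
wildcardKeyCode 1∈α *∈α 0∈β 1∈β = record
  { reading   = b1
  ; neutral   = star
  ; encode    = λ b → if b then b1 else b0
  ; reading∈α = 1∈α
  ; neutral∈α = *∈α
  ; encode∈β  = λ { true → 1∈β ; false → 0∈β }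
  ; T-reading = λ { true → refl ; false → refl }
  ; T-neutral = λ _ → refl
  }

wildcardLockCode : ∀ {α β} → InAlph α b0 → InAlph α b1 → InAlph β b0 → InAlph β star →
  OneHotCode α β
wildcardLockCode 0∈α 1∈α 0∈β *∈β = record
  { reading   = b1
  ; neutral   = b0
  ; encode    = λ b → if b then star else b0
  ; reading∈α = 1∈α
  ; neutral∈α = 0∈α
  ; encode∈β  = λ { true → *∈β ; false → 0∈β }
  ; T-reading = λ { true → refl ; false → refl }
  ; T-neutral = λ { true → refl ; false → refl }
  }

ListedScenario : Scen → Scen → Set
ListedScenario α β =
  (α ≡ ast × β ≡ circ) ⊎ (α ≡ circ × β ≡ ast) ⊎ (α ≡ ast × β ≡ ast) ⊎
  (α ≡ bul × β ≡ ast) ⊎ (α ≡ ast × β ≡ bul) ⊎ (α ≡ bul × β ≡ bul)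

listedScenarioCode : ∀ {α β} → ListedScenario α β → OneHotCode α β
listedScenarioCode (inj₁ (refl , refl))                             = wildcardKeyCode a1 a* c0 c1
listedScenarioCode (inj₂ (inj₁ (refl , refl)))                      = wildcardLockCode c0 c1 a0 a*
listedScenarioCode (inj₂ (inj₂ (inj₁ (refl , refl))))               = wildcardKeyCode a1 a* a0 a1
listedScenarioCode (inj₂ (inj₂ (inj₂ (inj₁ (refl , refl)))))        = wildcardKeyCode u1 u* a0 a1
listedScenarioCode (inj₂ (inj₂ (inj₂ (inj₂ (inj₁ (refl , refl)))))) = wildcardKeyCode a1 a* u0 u1
listedScenarioCode (inj₂ (inj₂ (inj₂ (inj₂ (inj₂ (refl , refl)))))) = wildcardKeyCode u1 u* u0 u1

proposition1 : (q n : ℕ) → 2 ≤ q → 1 ≤ n → q ≤ n →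
    (α β : Scen) →
    ((α ≡ ast × β ≡ circ) ⊎ (α ≡ circ × β ≡ ast) ⊎ (α ≡ ast × β ≡ ast) ⊎
    (α ≡ bul × β ≡ ast) ⊎ (α ≡ ast × β ≡ bul) ⊎ (α ≡ bul × β ≡ bul)) →
    (Φ : F q → Set) → Implementable α β q n Φ
proposition1 q n _ _ q≤n α β scenario = oneHot-implementable (listedScenarioCode scenario) q≤n
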